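{- Let $L$ be an $n\times n$ matrix with non-negative integer entries and all diagonal entries equal to zero. Then $\mathcal{A}(L)\neq\emptyset$ if and only if $L$ has no row with all entries equal to zero.
   Context: $\mathbb{N}_+$ denotes the positive integers. The set of arithmetical structures of $L$ is $\mathcal{A}(L)=\{(\mathbf{d},\mathbf{r})\in\mathbb{N}_+^n\times\mathbb{N}_+^n \mid (\mathrm{Diag}(\mathbf{d})-L)\mathbf{r}^t=\mathbf{0}^t \text{ and } \gcd(r_1,\ldots,r_n)=1\}$, where $\mathrm{Diag}(\mathbf{d})$ is the diagonal matrix with diagonal $\mathbf{d}$. -}

module Defs where

open import Data.Nat as ℕ using (ℕ; zero; suc; _≤_)
open import Data.Nat.GCD using (gcd)
open import Data.Integer as ℤ using (ℤ; +_; _-_; _*_; _+_)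
open import Data.Fin using (Fin; _≟_)
open import Data.Vec.Functional using (foldr)
open import Data.Product using (_×_; Σ)
open import Relation.Binary.PropositionalEquality using (_≡_)
open import Relation.Nullary.Decidable using (does)
open import Data.Bool using (if_then_else_)

Matrix : Set → ℕ → Set
Matrix A n = Fin n → Fin n → A

Vector : Set → ℕ → Set
Vector A n = Fin n → A

Σℤ : ∀ {n} → Vector ℤ n → ℤ
Σℤ = foldr _+_ (+ 0)

-- gcd(r₁,…,rₙ) (gcd of the empty family is 0)
gcdVec : ∀ {n} → Vector ℕ n → ℕ
gcdVec = foldr gcd 0

Diag : ∀ {n} → Vector ℕ n → Matrix ℕ n
Diag d i j = if does (i ≟ j) then d i else 0

DiagMinusApply : ∀ {n} → Vector ℕ n → Matrix ℕ n → Vector ℕ n → Vector ℤ n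
DiagMinusApply d L r i = Σℤ (λ j → ((+ Diag d i j) - (+ L i j)) * (+ r j))

Positive : ∀ {n} → Vector ℕ n → Set
Positive r = ∀ i → 1 ≤ r i

IsArithmeticalStructure : ∀ {n} → Matrix ℕ n → Vector ℕ n → Vector ℕ n → Set
IsArithmeticalStructure L d r =
  Positive d × Positive r × (∀ i → DiagMinusApply d L r i ≡ + 0) × gcdVec r ≡ 1

ArithNonempty : ∀ {n} → Matrix ℕ n → Set
ArithNonempty {n} L =
  Σ (Vector ℕ n) λ d → Σ (Vector ℕ n) λ r → IsArithmeticalStructure L d r

-- Row i of (Diag(d) − L) r is d_i r_i − Σⱼ L_ij r_j. A zero row i therefore forces d_i r_i = 0,
-- impossible for positive d and r. Conversely, if no row is zero, r = (1,…,1) together with the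
-- row sums d_i = Σⱼ L_ij is an arithmetical structure.
module Submission where

open import Defs
open import Data.Nat using (ℕ; _≤_)
open import Data.Fin using (Fin)
open import Data.Product using (∃)
open import Relation.Binary.PropositionalEquality using (_≡_)
open import Relation.Nullary using (¬_)
open import Function.Bundles using (_⇔_)

open import Data.Nat as ℕ using (zero; suc; _*_)
import Data.Nat.Properties as ℕ
open import Data.Nat.GCD using (gcd-zeroˡ)
open import Data.Integer as ℤ using (+_; _+_; _-_)
import Data.Integer.Properties as ℤ
open import Data.Integer.Solver using (module +-*-Solver)
open import Data.Fin using (zero; suc)
open import Data.Product using (_,_)
open import Function.Bundles using (mk⇔)
open import Relation.Binary.PropositionalEquality using (refl; sym; cong; cong₂; module ≡-Reasoning)
import Algebra.Properties.Group as GroupProperties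
open import Algebra.Bundles using (AbelianGroup)
import Algebra.Properties.CommutativeMonoid.Sum as Sum

module ℕΣ = Sum ℕ.+-0-commutativeMonoid
module ℤΣ = Sum ℤ.+-0-commutativeMonoid

open ℕΣ using (sum)

pos-sum : ∀ {n} (f : Vector ℕ n) → + sum f ≡ Σℤ (λ j → + f j)
pos-sum {zero}  f = refl
pos-sum {suc n} f = begin
  + (f zero ℕ.+ sum (λ j → f (suc j)))  ≡⟨ ℤ.pos-+ (f zero) _ ⟩
  + f zero + + sum (λ j → f (suc j))     ≡⟨ cong (λ s → + f zero + s) (pos-sum (λ j → f (suc j))) ⟩
  + f zero + Σℤ (λ j → + f (suc j))      ∎
  where open ≡-Reasoning

sum≡0⇒≡0 : ∀ {n} (f : Vector ℕ n) → sum f ≡ 0 → ∀ j → f j ≡ 0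
sum≡0⇒≡0 f Σf≡0 zero    = ℕ.m+n≡0⇒m≡0 (f zero) Σf≡0
sum≡0⇒≡0 f Σf≡0 (suc j) = sum≡0⇒≡0 (λ k → f (suc k)) (ℕ.m+n≡0⇒n≡0 (f zero) Σf≡0) j

sum-Diag*≡* : ∀ {n} (d r : Vector ℕ n) i → sum (λ j → Diag d i j * r j) ≡ d i * r i
sum-Diag*≡* {suc n} d r zero = begin
  d zero * r zero ℕ.+ sum {n} (λ _ → 0)  ≡⟨ cong (d zero * r zero ℕ.+_) (ℕΣ.sum-replicate-zero n) ⟩
  d zero * r zero ℕ.+ 0                  ≡⟨ ℕ.+-identityʳ _ ⟩
  d zero * r zero                        ∎
  where open ≡-Reasoning
sum-Diag*≡* {suc n} d r (suc i) = sum-Diag*≡* (λ k → d (suc k)) (λ k → r (suc k)) i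

-- Stated without subtraction on the right, so that it is proved by the termwise identity
-- (x − y) z + y z = x z.
DiagMinusApply+∑L*r≡d*r : ∀ {n} (d : Vector ℕ n) (L : Matrix ℕ n) (r : Vector ℕ n) i →
  DiagMinusApply d L r i + + sum (λ j → L i j * r j) ≡ + (d i * r i)
DiagMinusApply+∑L*r≡d*r d L r i = begin
  DiagMinusApply d L r i + + sum (λ j → L i j * r j)
    ≡⟨ cong (λ s → DiagMinusApply d L r i + s) (pos-sum (λ j → L i j * r j)) ⟩
  DiagMinusApply d L r i + Σℤ (λ j → + (L i j * r j))
    ≡⟨ sym (ℤΣ.∑-distrib-+ (λ j → (+ Diag d i j - + L i j) ℤ.* + r j) (λ j → + (L i j * r j))) ⟩
  Σℤ (λ j → (+ Diag d i j - + L i j) ℤ.* + r j + + (L i j * r j))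
    ≡⟨ ℤΣ.sum-cong-≗ (λ j → cancel (Diag d i j) (L i j) (r j)) ⟩
  Σℤ (λ j → + (Diag d i j * r j))
    ≡⟨ sym (pos-sum (λ j → Diag d i j * r j)) ⟩
  + sum (λ j → Diag d i j * r j)
    ≡⟨ cong +_ (sum-Diag*≡* d r i) ⟩
  + (d i * r i)
    ∎
  where
  open ≡-Reasoning
  open +-*-Solver
  cancel : ∀ x y z → (+ x - + y) ℤ.* + z + + (y * z) ≡ + (x * z)
  cancel x y z rewrite ℤ.pos-* y z | ℤ.pos-* x z =
    solve 3 (λ x y z → (x :- y) :* z :+ y :* z := x :* z) refl (+ x) (+ y) (+ z)

zero-row⇒¬arithmetical : ∀ {n} (L : Matrix ℕ n) i → (∀ j → L i j ≡ 0) →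
  ∀ d r → ¬ IsArithmeticalStructure L d r
zero-row⇒¬arithmetical {n} L i row≡0 d r (d>0 , r>0 , balanced , _) =
  ℕ.<⇒≢ (ℕ.*-mono-≤ (d>0 i) (r>0 i)) (sym (ℤ.+-injective d*r≡0))
  where
  open ≡-Reasoning
  d*r≡0 : + (d i * r i) ≡ + 0
  d*r≡0 = begin
    + (d i * r i)
      ≡⟨ sym (DiagMinusApply+∑L*r≡d*r d L r i) ⟩
    DiagMinusApply d L r i + + sum (λ j → L i j * r j)
      ≡⟨ cong₂ (λ a b → a + + b) (balanced i) (ℕΣ.sum-cong-≗ (λ j → cong (_* r j) (row≡0 j))) ⟩
    + 0 + + sum {n} (λ _ → 0)
      ≡⟨ cong +_ (ℕΣ.sum-replicate-zero n) ⟩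
    + 0
      ∎

rowSum : ∀ {n} → Matrix ℕ n → Vector ℕ n
rowSum L i = sum (L i)

nonzero-rows⇒arithmetical : ∀ {n} (L : Matrix ℕ (suc n)) → ¬ (∃ λ i → ∀ j → L i j ≡ 0) →
  IsArithmeticalStructure L (rowSum L) (λ _ → 1)
nonzero-rows⇒arithmetical {n} L no-zero-row =
  rowSum>0 , (λ _ → ℕ.≤-refl) , balanced , gcd-zeroˡ (gcdVec {n} (λ _ → 1))
  where
  open ≡-Reasoning
  rowSum>0 : ∀ i → 1 ≤ rowSum L i
  rowSum>0 i = ℕ.n≢0⇒n>0 (λ Σ≡0 → no-zero-row (i , sum≡0⇒≡0 (L i) Σ≡0))
  rowSum≡∑L*1 : ∀ i → rowSum L i ≡ sum (λ j → L i j * 1)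
  rowSum≡∑L*1 i = ℕΣ.sum-cong-≗ (λ j → sym (ℕ.*-identityʳ (L i j)))
  balanced : ∀ i → DiagMinusApply (rowSum L) L (λ _ → 1) i ≡ + 0
  balanced i = GroupProperties.identityˡ-unique (AbelianGroup.group ℤ.+-0-abelianGroup) _ _ (begin
    DiagMinusApply (rowSum L) L (λ _ → 1) i + + rowSum L i
      ≡⟨ cong (λ s → DiagMinusApply (rowSum L) L (λ _ → 1) i + + s) (rowSum≡∑L*1 i) ⟩
    DiagMinusApply (rowSum L) L (λ _ → 1) i + + sum (λ j → L i j * 1)
      ≡⟨ DiagMinusApply+∑L*r≡d*r (rowSum L) L (λ _ → 1) i ⟩
    + (rowSum L i * 1)
      ≡⟨ cong +_ (ℕ.*-identityʳ _) ⟩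
    + rowSum L i
      ∎)

proposition2p1 : (n : ℕ) → 1 ≤ n → (L : Matrix ℕ n) → (∀ i → L i i ≡ 0) →
    ArithNonempty L ⇔ (¬ ∃ λ (i : Fin n) → ∀ (j : Fin n) → L i j ≡ 0)
proposition2p1 (suc n) _ L _ = mk⇔
  (λ (d , r , arithmetical) (i , row≡0) → zero-row⇒¬arithmetical L i row≡0 d r arithmetical)
  (λ no-zero-row → _ , _ , nonzero-rows⇒arithmetical L no-zero-row)
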